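{- Let $K\ge1$ be an integer with $K\equiv 0$ or $2\pmod 4$, and let $p_1,\dots,p_r$ be the distinct primes dividing $K^2+4$. For every integer $m>1$ there exists $N$ such that for all $n\ge N$, $\pi_K^n(m)=p_1^{j_1}\cdots p_r^{j_r}$ for some integers $j_1,\dots,j_r\ge0$.
   Context: The $K$-Fibonacci sequence is $F_{K,0}=0$, $F_{K,1}=1$, $F_{K,n}=K F_{K,n-1}+F_{K,n-2}$; for an integer $m>1$, $\pi_K(m)$ is the length of its shortest period modulo $m$; iterates are $\pi_K^1=\pi_K$ and $\pi_K^{n+1}(m)=\pi_K(\pi_K^n(m))$. -}

module Defs where

open import Data.Nat using (ℕ; zero; suc; _+_; _*_; _^_; _<_; ∣_-_∣)
open import Data.Nat.Divisibility using (_∣_)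
open import Data.Product using (_×_)
open import Data.Vec using (Vec; foldr′; zipWith)

F : ℕ → ℕ → ℕ
F K zero = 0
F K (suc zero) = 1
F K (suc (suc n)) = K * F K (suc n) + F K n

_≡_[mod_] : ℕ → ℕ → ℕ → Set
a ≡ b [mod m ] = m ∣ ∣ a - b ∣

IsPeriod : ℕ → ℕ → ℕ → Set
IsPeriod K m p = 0 < p × (∀ n → F K (n + p) ≡ F K n [mod m ])

IsShortestPeriod : ℕ → ℕ → ℕ → Set
IsShortestPeriod K m p = IsPeriod K m p × (∀ q → IsPeriod K m q → p Data.Nat.≤ q)

prodPow : ∀ {r} → Vec ℕ r → Vec ℕ r → ℕ
prodPow ps js = foldr′ _*_ 1 (zipWith _^_ ps js)

{-# OPTIONS --safe #-}
-- π_K(m) is the multiplicative order of φ in ℤ[φ]/(m), where φ² = Kφ + 1, so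
-- periods can be computed in that ring.  Let K be even and D = K² + 4.
-- Modulo a prime p ∣ D the element φ is a root of unity times a unipotent element,
-- and D is a period.  Modulo an odd prime p ∤ D, with s = 2φ − K a square root of D,
-- the Frobenius x ↦ xᵖ fixes K and maps s to ±s, so φ^(p²) = φ and p² − 1 is a
-- period.  Moreover T ↦ pT lifts a period modulo m to one modulo pm when p ∣ m.
-- Hence every m has a period whose prime factors divide D or are at most the
-- largest prime factor of m, and a prime B ∤ D occurs in π(m) less often than in m,
-- since B ∤ B² − 1.  A descent on the largest prime factor not dividing D and on
-- its multiplicity shows that the iterates of π end up with all prime factors in D.
module Submission where

open import Algebra.Bundles using (CommutativeSemiring)
open import Algebra.Structures using (IsCommutativeSemiring)
open import Algebra.Structures.Biased using (isCommutativeSemiringˡ; isCommutativeMonoidˡ)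
open import Data.Fin.Base using (zero; suc; toℕ; fromℕ; inject₁)
import Data.Fin.Properties as Fin
open import Data.Integer.Base as ℤ using (ℤ; +_)
import Data.Integer.Coprimality as ℤ
import Data.Integer.Divisibility.Signed as Signed
import Data.Integer.Properties as ℤ
open import Data.Integer.Tactic.RingSolver using (solve)
open import Data.List.Base using ([]; _∷_)
open import Data.List.Relation.Unary.All as All using (All)
open import Data.Nat.Base as ℕ using (ℕ; zero; suc; _≤_; _<_; z≤n; s≤s; z<s; _!)
open import Data.Nat.Combinatorics using (_C_; nCn≡1; nCk≡n!/k![n-k]!; k![n∸k]!∣n!)
open import Data.Nat.Coprimality using (Coprime)
open import Data.Nat.DivMod using (m*[n/m]≡n; m%n<n; m≡m%n+[m/n]*n)
open import Data.Nat.Divisibility as ℕ using (_∣_; divides; _∣?_; ∣-trans)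
open import Data.Nat.GeneralisedArithmetic using (fold; fold-+)
open import Data.Nat.Induction using (<-wellFounded)
open import Data.Nat.ListAction using (product)
open import Data.Nat.ListAction.Properties using (∈⇒∣product)
open import Data.Nat.Primality using (Prime; euclidsLemma; prime⇒irreducible; prime⇒nonTrivial; prime?)
open import Data.Nat.Primality.Factorisation using (factorise; PrimeFactorisation)
import Data.Nat.Properties as ℕ
import Data.Nat.Tactic.RingSolver as ℕ-Solver
open import Data.Product using (Σ; ∃; ∃₂; _×_; _,_; proj₁; proj₂)
open import Data.Sum using (_⊎_; inj₁; inj₂; [_,_]′)
open import Data.Vec using (Vec; lookup)
open import Data.Vec.Base as Vec using (replicate; updateAt)
open import Function.Base using (id)
open import Function.Definitions using (Injective)
open import Induction.WellFounded using (Acc; acc)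
open import Level using (0ℓ)
open import Relation.Binary.PropositionalEquality as ≡ using (_≡_; _≢_; cong; cong₂; module ≡-Reasoning)
open import Relation.Binary.Structures using (IsEquivalence)
open import Relation.Nullary.Decidable using (yes; no; _×-dec_)
open import Relation.Nullary.Negation using (¬_; contradiction)
open import Relation.Unary using (Pred; Decidable)
open import Defs

least : ∀ {ℓ} {P : Pred ℕ ℓ} → Decidable P → ∀ {n} → P n → ∃ λ k → P k × (∀ {j} → P j → k ≤ j)
least {P = P} P? {n} Pn with search (suc n)
  where
  search : ∀ b → (∃ λ k → P k × (∀ {j} → P j → k ≤ j)) ⊎ (∀ {j} → j < b → ¬ P j)
  search zero = inj₂ λ ()
  search (suc b) with search b
  ... | inj₁ found = inj₁ found
  ... | inj₂ none with P? b
  ...   | yes Pb = inj₁ (b , Pb , λ Pj → ℕ.≮⇒≥ (λ j<b → none j<b Pj))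
  ...   | no ¬Pb = inj₂ λ j<1+b → [ none , (λ { ≡.refl → ¬Pb }) ]′ (ℕ.m<1+n⇒m<n∨m≡n j<1+b)
... | inj₁ found = found
... | inj₂ none  = contradiction Pn (none (ℕ.n<1+n n))

prime>1 : ∀ {p} → Prime p → 1 < p
prime>1 {p} p-prime = ℕ.nonTrivial⇒n>1 p {{prime⇒nonTrivial p-prime}}

prime≢1 : ∀ {p} → Prime p → p ≢ 1
prime≢1 p-prime p≡1 = ℕ.<-irrefl (≡.sym p≡1) (prime>1 p-prime)

n∣n! : ∀ n .{{_ : ℕ.NonZero n}} → n ∣ n !
n∣n! (suc n) = ℕ.m∣m*n (n !)

prime∤! : ∀ {p} → Prime p → ∀ {k} → k < p → ¬ p ∣ k !
prime∤! p-prime {zero}  _   p∣1   = prime≢1 p-prime (ℕ.∣1⇒≡1 p∣1)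
prime∤! p-prime {suc k} k<p p∣k!′ with euclidsLemma (suc k) (k !) p-prime p∣k!′
... | inj₁ p∣1+k = ℕ.<⇒≱ k<p (ℕ.∣⇒≤ p∣1+k)
... | inj₂ p∣k!  = prime∤! p-prime (ℕ.<-trans (ℕ.n<1+n k) k<p) p∣k!

prime∣pCk : ∀ {p k} → Prime p → 0 < k → k < p → p ∣ p C k
prime∣pCk {p} {k} p-prime 0<k k<p
  with euclidsLemma (k ! ℕ.* (p ℕ.∸ k) !) (p C k) p-prime (≡.subst (p ∣_) p!≡k![p-k]!pCk (n∣n! p {{p≢0}}))
  where
  instance _ = ℕ._!*_!≢0 k (p ℕ.∸ k)
  p≢0 = ℕ.>-nonZero (ℕ.<-trans z<s (prime>1 p-prime))
  p!≡k![p-k]!pCk : p ! ≡ k ! ℕ.* (p ℕ.∸ k) ! ℕ.* (p C k)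
  p!≡k![p-k]!pCk = ≡.sym (≡.trans (cong (k ! ℕ.* (p ℕ.∸ k) ! ℕ.*_) (nCk≡n!/k![n-k]! (ℕ.<⇒≤ k<p)))
                       (m*[n/m]≡n (k![n∸k]!∣n! (ℕ.<⇒≤ k<p))))
... | inj₂ p∣pCk = p∣pCk
... | inj₁ p∣k![p-k]! with euclidsLemma (k !) ((p ℕ.∸ k) !) p-prime p∣k![p-k]!
...   | inj₁ p∣k!     = contradiction p∣k! (prime∤! p-prime k<p)
...   | inj₂ p∣[p-k]! = contradiction p∣[p-k]! (prime∤! p-prime (ℕ.∸-monoʳ-< 0<k (ℕ.<⇒≤ k<p)))

prime-cancel : ∀ {p d a b} → Prime p → ¬ p ∣ d → (d ℕ.* a) ≡ (d ℕ.* b) [mod p ] → a ≡ b [mod p ]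
prime-cancel {p} {d} {a} {b} p-prime p∤d p∣d∣a-b∣
  with euclidsLemma d ℕ.∣ a - b ∣ p-prime (≡.subst (p ∣_) (≡.sym (ℕ.*-distribˡ-∣-∣ d a b)) p∣d∣a-b∣)
... | inj₁ p∣d     = contradiction p∣d p∤d
... | inj₂ p∣∣a-b∣ = p∣∣a-b∣

module CommutativeSemiringProperties {c ℓ} (R : CommutativeSemiring c ℓ) where

  open CommutativeSemiring R hiding (zero)
  open import Algebra.Definitions.RawSemiring rawSemiring using (_^_; sum) renaming (_×_ to _·_)
  open import Algebra.Properties.Semiring.Exp semiring using (^-congʳ)
  open import Algebra.Properties.Semiring.Mult semiring using (×-congʳ; ×-assocˡ; ×-homo-1; ×-comm-*)
  open import Algebra.Properties.Monoid.Sum +-monoid using (sum-cong-≋; sum-replicate-zero; sum-init-last)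
  open import Algebra.Properties.CommutativeSemiring.Binomial R using (theorem; binomialTerm)
  open import Relation.Binary.Reasoning.Setoid setoid

  1^n≈1 : ∀ n → 1# ^ n ≈ 1#
  1^n≈1 zero    = refl
  1^n≈1 (suc n) = trans (*-congˡ (1^n≈1 n)) (*-identityˡ 1#)

  ·-zeroʳ : ∀ n → n · 0# ≈ 0#
  ·-zeroʳ zero    = refl
  ·-zeroʳ (suc n) = trans (+-identityˡ (n · 0#)) (·-zeroʳ n)

  frobenius : ∀ {p} → Prime p → (∀ x → p · x ≈ 0#) → ∀ x y → (x + y) ^ p ≈ x ^ p + y ^ p
  frobenius {zero} p-prime with () ← prime>1 p-prime
  frobenius {p@(suc n)} p-prime p·≈0 x y = begin
    (x + y) ^ p                            ≈⟨ theorem p x y ⟩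
    term zero + sum (λ i → term (suc i))   ≈⟨ +-cong first (sum-init-last (λ i → term (suc i))) ⟩
    y ^ p + (sum (λ i → term (suc (inject₁ i))) + term (suc (fromℕ n)))
                                           ≈⟨ +-congˡ (+-cong middle (last (Fin.toℕ-fromℕ n))) ⟩
    y ^ p + (0# + x ^ p)                   ≈⟨ +-congˡ (+-identityˡ (x ^ p)) ⟩
    y ^ p + x ^ p                          ≈⟨ +-comm (y ^ p) (x ^ p) ⟩
    x ^ p + y ^ p                          ∎
    where
    term = binomialTerm x y p
    first : term zero ≈ y ^ p
    first = trans (×-homo-1 _) (*-identityˡ (y ^ p))
    binomial≈0 : ∀ {k} → 0 < k → k < p → ∀ z → (p C k) · z ≈ 0#
    binomial≈0 {k} 0<k k<p z with prime∣pCk p-prime 0<k k<p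
    ... | divides c eq = begin
      (p C k) · z       ≡⟨ cong (_· z) (≡.trans eq (ℕ.*-comm c p)) ⟩
      (p ℕ.* c) · z     ≈⟨ ×-assocˡ z p c ⟨
      p · (c · z)       ≈⟨ p·≈0 (c · z) ⟩
      0#                ∎
    middle : sum (λ i → term (suc (inject₁ i))) ≈ 0#
    middle = trans (sum-cong-≋ (λ i → binomial≈0 z<s (s≤s (toℕ-inject₁<n i)) _)) (sum-replicate-zero n)
      where
      toℕ-inject₁<n : ∀ i → toℕ (inject₁ i) < n
      toℕ-inject₁<n i = ≡.subst (_< n) (≡.sym (Fin.toℕ-inject₁ i)) (Fin.toℕ<n i)
    last : ∀ {j} → j ≡ n → (p C suc j) · (x ^ suc j * y ^ (p ℕ.∸ suc j)) ≈ x ^ p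
    last ≡.refl = begin
      (p C p) · (x ^ p * y ^ (n ℕ.∸ n))   ≡⟨ cong (_· (x ^ p * y ^ (n ℕ.∸ n))) (nCn≡1 p) ⟩
      1 · (x ^ p * y ^ (n ℕ.∸ n))         ≈⟨ ×-homo-1 _ ⟩
      x ^ p * y ^ (n ℕ.∸ n)               ≈⟨ *-congˡ (^-congʳ y (ℕ.n∸n≡0 n)) ⟩
      x ^ p * 1#                          ≈⟨ *-identityʳ (x ^ p) ⟩
      x ^ p                               ∎

  fermat : ∀ {p} → Prime p → (∀ x → p · x ≈ 0#) → ∀ n → (n · 1#) ^ p ≈ n · 1#
  fermat {zero}  p-prime with () ← prime>1 p-prime
  fermat {suc _} p-prime p·≈0 zero    = zeroˡ _
  fermat {p}     p-prime p·≈0 (suc n) = begin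
    (1# + n · 1#) ^ p         ≈⟨ frobenius p-prime p·≈0 1# (n · 1#) ⟩
    1# ^ p + (n · 1#) ^ p     ≈⟨ +-cong (1^n≈1 p) (fermat p-prime p·≈0 n) ⟩
    1# + n · 1#               ∎

  square-zero-binomial : ∀ {y} → y * y ≈ 0# → ∀ k → (1# + y) ^ k ≈ 1# + k · y
  square-zero-binomial {y} y²≈0 zero    = sym (+-identityʳ 1#)
  square-zero-binomial {y} y²≈0 (suc k) = begin
    (1# + y) * (1# + y) ^ k                      ≈⟨ *-congˡ (square-zero-binomial y²≈0 k) ⟩
    (1# + y) * (1# + k · y)                      ≈⟨ distribʳ (1# + k · y) 1# y ⟩
    1# * (1# + k · y) + y * (1# + k · y)         ≈⟨ +-cong (*-identityˡ _) (distribˡ y 1# (k · y)) ⟩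
    (1# + k · y) + (y * 1# + y * (k · y))        ≈⟨ +-congˡ (+-cong (*-identityʳ y) y·ky≈0) ⟩
    (1# + k · y) + (y + 0#)                      ≈⟨ +-congˡ (+-identityʳ y) ⟩
    (1# + k · y) + y                             ≈⟨ +-assoc 1# (k · y) y ⟩
    1# + (k · y + y)                             ≈⟨ +-congˡ (+-comm (k · y) y) ⟩
    1# + (y + k · y)                             ∎
    where
    y·ky≈0 : y * (k · y) ≈ 0#
    y·ky≈0 = trans (×-comm-* k y y) (trans (×-congʳ k y²≈0) (·-zeroʳ k))

-- Congruences of integers

module _ where

  open import Data.Integer.Base using (_+_; _*_; -_; _-_)

  infix 4 _≡_[modℤ_]

  -- The quotient is stored so that proofs can match the equation with refl and close goals by solve.
  record _≡_[modℤ_] (a b M : ℤ) : Set where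
    constructor withQuotient
    field
      quotient : ℤ
      equation : a ≡ b + quotient * M

  module _ {M : ℤ} where

    modℤ-reflexive : ∀ {a b} → a ≡ b → a ≡ b [modℤ M ]
    modℤ-reflexive {b = b} ≡.refl = withQuotient (+ 0) (solve (b ∷ M ∷ []))

    modℤ-refl : ∀ {a} → a ≡ a [modℤ M ]
    modℤ-refl = modℤ-reflexive ≡.refl

    modℤ-sym : ∀ {a b} → a ≡ b [modℤ M ] → b ≡ a [modℤ M ]
    modℤ-sym {b = b} (withQuotient q ≡.refl) = withQuotient (- q) (solve (b ∷ q ∷ M ∷ []))

    modℤ-trans : ∀ {a b c} → a ≡ b [modℤ M ] → b ≡ c [modℤ M ] → a ≡ c [modℤ M ]
    modℤ-trans {c = c} (withQuotient q ≡.refl) (withQuotient r ≡.refl) =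
      withQuotient (r + q) (solve (c ∷ q ∷ r ∷ M ∷ []))

    modℤ-+ : ∀ {a b c d} → a ≡ b [modℤ M ] → c ≡ d [modℤ M ] → a + c ≡ b + d [modℤ M ]
    modℤ-+ {b = b} {d = d} (withQuotient q ≡.refl) (withQuotient r ≡.refl) =
      withQuotient (q + r) (solve (b ∷ d ∷ q ∷ r ∷ M ∷ []))

    modℤ-* : ∀ {a b c d} → a ≡ b [modℤ M ] → c ≡ d [modℤ M ] → a * c ≡ b * d [modℤ M ]
    modℤ-* {b = b} {d = d} (withQuotient q ≡.refl) (withQuotient r ≡.refl) =
      withQuotient (q * d + b * r + q * r * M) (solve (b ∷ d ∷ q ∷ r ∷ M ∷ []))

    modℤ⇒∣ : ∀ {a b} → a ≡ b [modℤ M ] → M Signed.∣ a - b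
    modℤ⇒∣ {b = b} (withQuotient q ≡.refl) = Signed.divides q (solve (b ∷ q ∷ M ∷ []))

    ∣⇒modℤ : ∀ {a b} → M Signed.∣ a - b → a ≡ b [modℤ M ]
    ∣⇒modℤ {a} {b} (Signed.divides q a-b≡qM) = withQuotient q (begin
      a             ≡⟨ solve (a ∷ b ∷ []) ⟩
      b + (a - b)   ≡⟨ cong (_+_ b) a-b≡qM ⟩
      b + q * M     ∎)
      where open ≡-Reasoning

  modℤ-1 : ∀ a b → a ≡ b [modℤ + 1 ]
  modℤ-1 a b = withQuotient (a - b) (solve (a ∷ b ∷ []))

  modℤ-∣ : ∀ {D M a b} → D Signed.∣ M → a ≡ b [modℤ M ] → a ≡ b [modℤ D ]
  modℤ-∣ {D} {b = b} (Signed.divides c ≡.refl) (withQuotient q ≡.refl) =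
    withQuotient (q * c) (solve (b ∷ q ∷ c ∷ D ∷ []))

  modℤ-coprime : ∀ {M N a b} → ℤ.Coprime M N → a ≡ b [modℤ M ] → a ≡ b [modℤ N ] → a ≡ b [modℤ M * N ]
  modℤ-coprime {M} {N} {b = b} M⊥N (withQuotient q ≡.refl) (withQuotient r eq)
    with Signed.∣ᵤ⇒∣ {N} {q} (ℤ.coprime-divisor N M q (ℤ.sym {M} {N} M⊥N) (Signed.∣⇒∣ᵤ (Signed.divides r Mq≡rN)))
    where
    Mq≡rN : M * q ≡ r * N
    Mq≡rN = begin
      M * q           ≡⟨ solve (b ∷ q ∷ M ∷ []) ⟩
      b + q * M - b   ≡⟨ cong (_- b) eq ⟩
      b + r * N - b   ≡⟨ solve (b ∷ r ∷ N ∷ []) ⟩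
      r * N           ∎
      where open ≡-Reasoning
  ... | Signed.divides t q≡tN = withQuotient t (begin
    b + q * M         ≡⟨ cong (λ x → b + x * M) q≡tN ⟩
    b + t * N * M     ≡⟨ solve (b ∷ t ∷ M ∷ N ∷ []) ⟩
    b + t * (M * N)   ∎)
    where open ≡-Reasoning

  ∣+a-+b∣≡∣a-b∣ : ∀ a b → ℤ.∣ + a - + b ∣ ≡ ℕ.∣ a - b ∣
  ∣+a-+b∣≡∣a-b∣ a b = [ ≤-case , ≥-case ]′ (ℕ.≤-total a b)
    where
    open ≡-Reasoning
    ≤-case : ∀ {a b} → a ≤ b → ℤ.∣ + a - + b ∣ ≡ ℕ.∣ a - b ∣
    ≤-case {a} {b} a≤b = begin
      ℤ.∣ + a - + b ∣   ≡⟨ cong ℤ.∣_∣ (ℤ.m-n≡m⊖n a b) ⟩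
      ℤ.∣ a ℤ.⊖ b ∣     ≡⟨ ℤ.∣⊖∣-≤ a≤b ⟩
      b ℕ.∸ a           ≡⟨ ℕ.m≤n⇒∣m-n∣≡n∸m a≤b ⟨
      ℕ.∣ a - b ∣       ∎
    ≥-case : b ≤ a → ℤ.∣ + a - + b ∣ ≡ ℕ.∣ a - b ∣
    ≥-case b≤a = begin
      ℤ.∣ + a - + b ∣   ≡⟨ ℤ.∣i-j∣≡∣j-i∣ (+ a) (+ b) ⟩
      ℤ.∣ + b - + a ∣   ≡⟨ ≤-case b≤a ⟩
      ℕ.∣ b - a ∣       ≡⟨ ℕ.∣-∣-comm b a ⟩
      ℕ.∣ a - b ∣       ∎

  modℤ⇒mod : ∀ {a b m} → + a ≡ + b [modℤ + m ] → a ≡ b [mod m ]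
  modℤ⇒mod {a} {b} {m} a≡b = ≡.subst (m ∣_) (∣+a-+b∣≡∣a-b∣ a b) (Signed.∣⇒∣ᵤ (modℤ⇒∣ a≡b))

  mod⇒modℤ : ∀ {a b m} → a ≡ b [mod m ] → + a ≡ + b [modℤ + m ]
  mod⇒modℤ {a} {b} {m} a≡b = ∣⇒modℤ (Signed.∣ᵤ⇒∣ (≡.subst (m ∣_) (≡.sym (∣+a-+b∣≡∣a-b∣ a b)) a≡b))

-- The rings ℤ[φ]/(M) with φ² = kφ + 1

module ℤ[φ] (k : ℤ) where

  open import Data.Integer.Base using (_+_; _*_; -_; _-_)

  infix  4 _≈_[mod_]
  infix  5 _+φ_
  infixl 6 _⊕_
  infixl 7 _⊗_
  infixr 8 _^_

  -- a +φ b stands for a + bφ.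
  data Elt : Set where
    _+φ_ : ℤ → ℤ → Elt

  _⊕_ _⊗_ : Elt → Elt → Elt
  (a +φ b) ⊕ (c +φ d) = (a + c) +φ (b + d)
  (a +φ b) ⊗ (c +φ d) = (a * c + b * d) +φ (a * d + b * c + k * (b * d))

  𝟘 𝟙 φ : Elt
  𝟘 = + 0 +φ + 0
  𝟙 = + 1 +φ + 0
  φ = + 0 +φ + 1

  ι : ℤ → Elt
  ι c = c +φ + 0

  -- Unlike the powers of the semirings below, this one does not depend on the modulus.
  _^_ : Elt → ℕ → Elt
  x ^ zero  = 𝟙
  x ^ suc n = x ⊗ x ^ n

  re im : Elt → ℤ
  re (a +φ _) = a
  im (_ +φ b) = b

  record _≈_[mod_] (x y : Elt) (M : ℤ) : Set where
    constructor _,_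
    field
      re-≡ : re x ≡ re y [modℤ M ]
      im-≡ : im x ≡ im y [modℤ M ]

  +φ-cong : ∀ {M a b c d} → a ≡ c [modℤ M ] → b ≡ d [modℤ M ] → a +φ b ≈ c +φ d [mod M ]
  +φ-cong = _,_

  +φ-≡ : ∀ {M a b c d} → a ≡ c → b ≡ d → a +φ b ≈ c +φ d [mod M ]
  +φ-≡ a≡c b≡d = modℤ-reflexive a≡c , modℤ-reflexive b≡d

  module _ (M : ℤ) where

    private
      infix 4 _≈_
      _≈_ : Elt → Elt → Set
      x ≈ y = x ≈ y [mod M ]

    ≈-isEquivalence : IsEquivalence _≈_
    ≈-isEquivalence = record
      { refl  = modℤ-refl , modℤ-refl
      ; sym   = λ (a , b) → modℤ-sym a , modℤ-sym b
      ; trans = λ (a , b) (c , d) → modℤ-trans a c , modℤ-trans b d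
      }

    ⊕-cong : ∀ {x y u v} → x ≈ y → u ≈ v → x ⊕ u ≈ y ⊕ v
    ⊕-cong {_ +φ _} {_ +φ _} {_ +φ _} {_ +φ _} (a , b) (c , d) = modℤ-+ a c , modℤ-+ b d

    ⊗-cong : ∀ {x y u v} → x ≈ y → u ≈ v → x ⊗ u ≈ y ⊗ v
    ⊗-cong {_ +φ _} {_ +φ _} {_ +φ _} {_ +φ _} (a , b) (c , d) =
      modℤ-+ (modℤ-* a c) (modℤ-* b d) ,
      modℤ-+ (modℤ-+ (modℤ-* a d) (modℤ-* b c)) (modℤ-* (modℤ-refl {a = k}) (modℤ-* b d))

    isCommutativeSemiring : IsCommutativeSemiring _≈_ _⊕_ _⊗_ 𝟘 𝟙
    isCommutativeSemiring = isCommutativeSemiringˡ record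
      { +-isCommutativeMonoid = isCommutativeMonoidˡ record
        { isSemigroup = record
          { isMagma = record { isEquivalence = ≈-isEquivalence ; ∙-cong = ⊕-cong }
          ; assoc   = λ { (a +φ b) (c +φ d) (e +φ f) →
              +φ-≡ (solve (a ∷ c ∷ e ∷ [])) (solve (b ∷ d ∷ f ∷ [])) }
          }
        ; identityˡ = λ { (a +φ b) → +φ-≡ (solve (a ∷ [])) (solve (b ∷ [])) }
        ; comm      = λ { (a +φ b) (c +φ d) → +φ-≡ (solve (a ∷ c ∷ [])) (solve (b ∷ d ∷ [])) }
        }
      ; *-isCommutativeMonoid = isCommutativeMonoidˡ record
        { isSemigroup = record
          { isMagma = record { isEquivalence = ≈-isEquivalence ; ∙-cong = ⊗-cong }
          ; assoc   = λ { (a +φ b) (c +φ d) (e +φ f) →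
              +φ-≡ (solve (a ∷ b ∷ c ∷ d ∷ e ∷ f ∷ k ∷ [])) (solve (a ∷ b ∷ c ∷ d ∷ e ∷ f ∷ k ∷ [])) }
          }
        ; identityˡ = λ { (a +φ b) → +φ-≡ (solve (a ∷ b ∷ [])) (solve (a ∷ b ∷ k ∷ [])) }
        ; comm      = λ { (a +φ b) (c +φ d) →
            +φ-≡ (solve (a ∷ b ∷ c ∷ d ∷ [])) (solve (a ∷ b ∷ c ∷ d ∷ k ∷ [])) }
        }
      ; distribʳ = λ { (a +φ b) (c +φ d) (e +φ f) →
          +φ-≡ (solve (a ∷ b ∷ c ∷ d ∷ e ∷ f ∷ [])) (solve (a ∷ b ∷ c ∷ d ∷ e ∷ f ∷ k ∷ [])) }
      ; zeroˡ = λ { (a +φ b) → +φ-≡ (solve (a ∷ b ∷ [])) (solve (a ∷ b ∷ k ∷ [])) }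
      }

    commutativeSemiring : CommutativeSemiring 0ℓ 0ℓ
    commutativeSemiring = record { isCommutativeSemiring = isCommutativeSemiring }

  module Mod (M : ℤ) where
    open CommutativeSemiring (commutativeSemiring M) public using (setoid; refl; sym; trans)
    open CommutativeSemiring (commutativeSemiring M) using (*-identityˡ; semiring)
    open import Algebra.Definitions.RawSemiring (CommutativeSemiring.rawSemiring (commutativeSemiring M)) public
      using () renaming (_×_ to _·_; _^_ to _^ᴿ_)
    open import Algebra.Properties.Semiring.Mult semiring using (×-assoc-*; ×-congʳ)
    open import Algebra.Properties.Semiring.Exp semiring as Exp using ()
    open import Algebra.Properties.CommutativeSemiring.Exp (commutativeSemiring M) as CExp using ()
    open import Relation.Binary.Reasoning.Setoid setoid

    ^≡^ᴿ : ∀ x n → x ^ n ≡ x ^ᴿ n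
    ^≡^ᴿ x zero    = ≡.refl
    ^≡^ᴿ x (suc n) = cong (x ⊗_) (^≡^ᴿ x n)

    ·𝟙≡ι : ∀ n → n · 𝟙 ≡ ι (+ n)
    ·𝟙≡ι zero    = ≡.refl
    ·𝟙≡ι (suc n) = cong (𝟙 ⊕_) (·𝟙≡ι n)

    ·≈ι⊗ : ∀ n x → n · x ≈ ι (+ n) ⊗ x [mod M ]
    ·≈ι⊗ n x = begin
      n · x          ≈⟨ ×-congʳ n (*-identityˡ x) ⟨
      n · (𝟙 ⊗ x)    ≈⟨ ×-assoc-* n 𝟙 x ⟨
      (n · 𝟙) ⊗ x    ≡⟨ cong (_⊗ x) (·𝟙≡ι n) ⟩
      ι (+ n) ⊗ x    ∎

    ^-homo-⊗ : ∀ x m n → x ^ (m ℕ.+ n) ≈ x ^ m ⊗ x ^ n [mod M ]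
    ^-homo-⊗ x m n = begin
      x ^ (m ℕ.+ n)       ≡⟨ ^≡^ᴿ x (m ℕ.+ n) ⟩
      x ^ᴿ (m ℕ.+ n)      ≈⟨ Exp.^-homo-* x m n ⟩
      x ^ᴿ m ⊗ x ^ᴿ n     ≡⟨ cong₂ _⊗_ (^≡^ᴿ x m) (^≡^ᴿ x n) ⟨
      x ^ m ⊗ x ^ n       ∎

    ^-assocʳ : ∀ x m n → (x ^ m) ^ n ≈ x ^ (m ℕ.* n) [mod M ]
    ^-assocʳ x m n = begin
      (x ^ m) ^ n         ≡⟨ ≡.trans (^≡^ᴿ (x ^ m) n) (cong (_^ᴿ n) (^≡^ᴿ x m)) ⟩
      (x ^ᴿ m) ^ᴿ n       ≈⟨ Exp.^-assocʳ x m n ⟩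
      x ^ᴿ (m ℕ.* n)      ≡⟨ ^≡^ᴿ x (m ℕ.* n) ⟨
      x ^ (m ℕ.* n)       ∎

    ^-congˡ : ∀ {x y} n → x ≈ y [mod M ] → x ^ n ≈ y ^ n [mod M ]
    ^-congˡ {x} {y} n x≈y = begin
      x ^ n     ≡⟨ ^≡^ᴿ x n ⟩
      x ^ᴿ n    ≈⟨ Exp.^-congˡ n x≈y ⟩
      y ^ᴿ n    ≡⟨ ^≡^ᴿ y n ⟨
      y ^ n     ∎

    ^-distrib-⊗ : ∀ x y n → (x ⊗ y) ^ n ≈ x ^ n ⊗ y ^ n [mod M ]
    ^-distrib-⊗ x y n = begin
      (x ⊗ y) ^ n         ≡⟨ ^≡^ᴿ (x ⊗ y) n ⟩
      (x ⊗ y) ^ᴿ n        ≈⟨ CExp.^-distrib-* x y n ⟩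
      x ^ᴿ n ⊗ y ^ᴿ n     ≡⟨ cong₂ _⊗_ (^≡^ᴿ x n) (^≡^ᴿ y n) ⟨
      x ^ n ⊗ y ^ n       ∎

    𝟙^n≈𝟙 : ∀ n → 𝟙 ^ n ≈ 𝟙 [mod M ]
    𝟙^n≈𝟙 n = ≡.subst (_≈ 𝟙 [mod M ]) (≡.sym (^≡^ᴿ 𝟙 n))
                (CommutativeSemiringProperties.1^n≈1 (commutativeSemiring M) n)

    square-zero-binomial : ∀ {y} → y ⊗ y ≈ 𝟘 [mod M ] → ∀ n → (𝟙 ⊕ y) ^ n ≈ 𝟙 ⊕ ι (+ n) ⊗ y [mod M ]
    square-zero-binomial {y} y²≈0 n = begin
      (𝟙 ⊕ y) ^ n        ≡⟨ ^≡^ᴿ (𝟙 ⊕ y) n ⟩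
      (𝟙 ⊕ y) ^ᴿ n       ≈⟨ CommutativeSemiringProperties.square-zero-binomial (commutativeSemiring M) y²≈0 n ⟩
      𝟙 ⊕ n · y          ≈⟨ ⊕-cong M {𝟙} refl (·≈ι⊗ n y) ⟩
      𝟙 ⊕ ι (+ n) ⊗ y    ∎

  ι-⊗≈𝟘 : ∀ {M c} → M Signed.∣ c → ∀ x → ι c ⊗ x ≈ 𝟘 [mod M ]
  ι-⊗≈𝟘 {M} (Signed.divides q ≡.refl) (a +φ b) =
    +φ-cong (withQuotient (q * a) (solve (q ∷ M ∷ a ∷ b ∷ []))) (withQuotient (q * b) (solve (q ∷ M ∷ a ∷ b ∷ k ∷ [])))

  ι-⊗-ι : ∀ {M} a b → ι a ⊗ ι b ≈ ι (a * b) [mod M ]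
  ι-⊗-ι a b = +φ-≡ (solve (a ∷ b ∷ [])) (solve (a ∷ b ∷ k ∷ []))

  ι-^ : ∀ {M} a n → ι (+ a) ^ n ≈ ι (+ (a ℕ.^ n)) [mod M ]
  ι-^ a zero        = +φ-≡ ≡.refl ≡.refl
  ι-^ {M} a (suc n) = begin
    ι (+ a) ⊗ ι (+ a) ^ n            ≈⟨ ⊗-cong M {ι (+ a)} refl (ι-^ a n) ⟩
    ι (+ a) ⊗ ι (+ (a ℕ.^ n))        ≈⟨ ι-⊗-ι (+ a) (+ (a ℕ.^ n)) ⟩
    ι (+ a * + (a ℕ.^ n))            ≡⟨ cong ι (ℤ.pos-* a (a ℕ.^ n)) ⟨
    ι (+ (a ℕ.^ suc n))              ∎
    where
    open Mod M
    open import Relation.Binary.Reasoning.Setoid setoid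

  ·≈𝟘 : ∀ n x → Mod._·_ (+ n) n x ≈ 𝟘 [mod + n ]
  ·≈𝟘 n x = Mod.trans (+ n) (Mod.·≈ι⊗ (+ n) n x) (ι-⊗≈𝟘 Signed.∣-refl x)

  ≈-∣ : ∀ {D M x y} → D Signed.∣ M → x ≈ y [mod M ] → x ≈ y [mod D ]
  ≈-∣ D∣M (a , b) = modℤ-∣ D∣M a , modℤ-∣ D∣M b

  ≈-coprime : ∀ {M N x y} → ℤ.Coprime M N → x ≈ y [mod M ] → x ≈ y [mod N ] → x ≈ y [mod M * N ]
  ≈-coprime M⊥N (a , b) (c , d) = modℤ-coprime M⊥N a c , modℤ-coprime M⊥N b d

  multiple²≈𝟘 : ∀ M a b → (a * M +φ b * M) ⊗ (a * M +φ b * M) ≈ 𝟘 [mod M * M ]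
  multiple²≈𝟘 M a b = +φ-cong (withQuotient (a * a + b * b) (solve (a ∷ b ∷ M ∷ [])))
                              (withQuotient (a * b + b * a + k * (b * b)) (solve (a ∷ b ∷ M ∷ k ∷ [])))

  ι-⊗-multiple≈𝟘 : ∀ P M a b → ι P ⊗ (a * M +φ b * M) ≈ 𝟘 [mod P * M ]
  ι-⊗-multiple≈𝟘 P M a b = +φ-cong (withQuotient a (solve (P ∷ a ∷ b ∷ M ∷ [])))
                                   (withQuotient b (solve (P ∷ a ∷ b ∷ M ∷ k ∷ [])))

  -- Writing x = 1 + y with y ≡ 0 modulo M, the binomial terms beyond the linear one vanish modulo M².
  ^-lift : ∀ {M x} p → + p Signed.∣ M → x ≈ 𝟙 [mod M ] → x ^ p ≈ 𝟙 [mod + p * M ]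
  ^-lift {M} {_ +φ _} p p∣M (withQuotient q₀ ≡.refl , withQuotient q₁ ≡.refl) = begin
    (𝟙 ⊕ y) ^ p          ≈⟨ ≈-∣ (Signed.*-monoˡ-∣ M p∣M) (Mod.square-zero-binomial (M * M) (multiple²≈𝟘 M q₀ q₁) p) ⟩
    𝟙 ⊕ ι (+ p) ⊗ y      ≈⟨ ⊕-cong (+ p * M) {𝟙} refl (ι-⊗-multiple≈𝟘 (+ p) M q₀ q₁) ⟩
    𝟙 ⊕ 𝟘                ≈⟨ +φ-≡ (ℤ.+-identityʳ (+ 1)) (ℤ.+-identityʳ (+ 0)) ⟩
    𝟙                    ∎
    where
    y = q₀ * M +φ q₁ * M
    open Mod (+ p * M)
    open import Relation.Binary.Reasoning.Setoid setoid

  φ-⊗ : ∀ a b → φ ⊗ (a +φ b) ≡ b +φ (a + k * b)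
  φ-⊗ a b = cong₂ _+φ_ (solve (a ∷ b ∷ [])) (solve (a ∷ b ∷ k ∷ []))

  φ⁻¹ : Elt
  φ⁻¹ = - k +φ + 1

  φ⁻¹-⊗-φ-⊗ : ∀ {M} x → φ⁻¹ ⊗ (φ ⊗ x) ≈ x [mod M ]
  φ⁻¹-⊗-φ-⊗ (a +φ b) = +φ-≡ (solve (a ∷ b ∷ k ∷ [])) (solve (a ∷ b ∷ k ∷ []))

  φ-cancel : ∀ {M x y} → φ ⊗ x ≈ φ ⊗ y [mod M ] → x ≈ y [mod M ]
  φ-cancel {M} {x} {y} φx≈φy = begin
    x                  ≈⟨ φ⁻¹-⊗-φ-⊗ x ⟨
    φ⁻¹ ⊗ (φ ⊗ x)      ≈⟨ ⊗-cong M {φ⁻¹} refl φx≈φy ⟩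
    φ⁻¹ ⊗ (φ ⊗ y)      ≈⟨ φ⁻¹-⊗-φ-⊗ y ⟩
    y                  ∎
    where
    open Mod M
    open import Relation.Binary.Reasoning.Setoid setoid

  s : Elt
  s = - k +φ + 2

  s⊗s≈ι : ∀ {M} → s ⊗ s ≈ ι (k * k + + 4) [mod M ]
  s⊗s≈ι = +φ-≡ (solve (k ∷ [])) (solve (k ∷ []))

  -- c + 1 is the inverse of 2 modulo 2c + 1, and 2φ = ι k ⊕ s.
  ι[c+1]⊗[ιk⊕s]≈φ : ∀ {M c} → M ≡ c + c + + 1 → ι (c + + 1) ⊗ (ι k ⊕ s) ≈ φ [mod M ]
  ι[c+1]⊗[ιk⊕s]≈φ {c = c} ≡.refl =
    +φ-cong (withQuotient (+ 0) (solve (c ∷ k ∷ []))) (withQuotient (+ 1) (solve (c ∷ k ∷ [])))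

  module _ {p} (p-prime : Prime p) where
    open Mod (+ p)
    open import Relation.Binary.Reasoning.Setoid setoid
    private
      module Char-p = CommutativeSemiringProperties (commutativeSemiring (+ p))

    frobenius : ∀ x y → (x ⊕ y) ^ p ≈ x ^ p ⊕ y ^ p [mod + p ]
    frobenius x y = begin
      (x ⊕ y) ^ p         ≡⟨ ^≡^ᴿ (x ⊕ y) p ⟩
      (x ⊕ y) ^ᴿ p        ≈⟨ Char-p.frobenius p-prime (·≈𝟘 p) x y ⟩
      x ^ᴿ p ⊕ y ^ᴿ p     ≡⟨ cong₂ _⊕_ (^≡^ᴿ x p) (^≡^ᴿ y p) ⟨
      x ^ p ⊕ y ^ p       ∎

    fermat : ∀ n → ι (+ n) ^ p ≈ ι (+ n) [mod + p ]
    fermat n = begin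
      ι (+ n) ^ p         ≡⟨ ≡.trans (^≡^ᴿ (ι (+ n)) p) (cong (_^ᴿ p) (≡.sym (·𝟙≡ι n))) ⟩
      (n · 𝟙) ^ᴿ p        ≈⟨ Char-p.fermat p-prime (·≈𝟘 p) n ⟩
      n · 𝟙               ≡⟨ ·𝟙≡ι n ⟩
      ι (+ n)             ∎

    ι[dʰ]⊗ι[dʰ]≈𝟙 : ∀ {h d} → p ≡ suc (2 ℕ.* h) → ¬ p ∣ d → ι (+ (d ℕ.^ h)) ⊗ ι (+ (d ℕ.^ h)) ≈ 𝟙 [mod + p ]
    ι[dʰ]⊗ι[dʰ]≈𝟙 {h} {d} p≡1+2h p∤d = begin
      ι (+ dʰ) ⊗ ι (+ dʰ)          ≈⟨ ι-⊗-ι (+ dʰ) (+ dʰ) ⟩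
      ι (+ dʰ * + dʰ)              ≡⟨ cong ι (≡.trans (cong +_ d²ʰ≡dʰ*dʰ) (ℤ.pos-* dʰ dʰ)) ⟨
      ι (+ (d ℕ.^ (2 ℕ.* h)))      ≈⟨ +φ-cong (mod⇒modℤ (prime-cancel p-prime p∤d d·d²ʰ≡d·1)) modℤ-refl ⟩
      𝟙                            ∎
      where
      dʰ = d ℕ.^ h
      d²ʰ≡dʰ*dʰ : d ℕ.^ (2 ℕ.* h) ≡ dʰ ℕ.* dʰ
      d²ʰ≡dʰ*dʰ = ≡.trans (cong (λ n → d ℕ.^ (h ℕ.+ n)) (ℕ.+-identityʳ h)) (ℕ.^-distribˡ-+-* d h h)
      d·d²ʰ≡d·1 : (d ℕ.* d ℕ.^ (2 ℕ.* h)) ≡ (d ℕ.* 1) [mod p ]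
      d·d²ʰ≡d·1 = ≡.subst₂ (_≡_[mod p ]) (cong (d ℕ.^_) p≡1+2h) (≡.sym (ℕ.*-identityʳ d))
                    (modℤ⇒mod (_≈_[mod_].re-≡ (trans (sym (ι-^ d p)) (fermat d))))

    Frobenius²-fixed : Elt → Set
    Frobenius²-fixed x = (x ^ p) ^ p ≈ x [mod + p ]

    ι-fixed : ∀ n → Frobenius²-fixed (ι (+ n))
    ι-fixed n = trans (^-congˡ p (fermat n)) (fermat n)

    ⊕-fixed : ∀ {x y} → Frobenius²-fixed x → Frobenius²-fixed y → Frobenius²-fixed (x ⊕ y)
    ⊕-fixed {x} {y} x-fixed y-fixed = begin
      ((x ⊕ y) ^ p) ^ p            ≈⟨ ^-congˡ p (frobenius x y) ⟩
      (x ^ p ⊕ y ^ p) ^ p          ≈⟨ frobenius (x ^ p) (y ^ p) ⟩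
      (x ^ p) ^ p ⊕ (y ^ p) ^ p    ≈⟨ ⊕-cong (+ p) x-fixed y-fixed ⟩
      x ⊕ y                        ∎

    ⊗-fixed : ∀ {x y} → Frobenius²-fixed x → Frobenius²-fixed y → Frobenius²-fixed (x ⊗ y)
    ⊗-fixed {x} {y} x-fixed y-fixed = begin
      ((x ⊗ y) ^ p) ^ p            ≈⟨ ^-congˡ p (^-distrib-⊗ x y p) ⟩
      (x ^ p ⊗ y ^ p) ^ p          ≈⟨ ^-distrib-⊗ (x ^ p) (y ^ p) p ⟩
      (x ^ p) ^ p ⊗ (y ^ p) ^ p    ≈⟨ ⊗-cong (+ p) x-fixed y-fixed ⟩
      x ⊗ y                        ∎

  record Period (m T : ℕ) : Set where
    constructor period
    field
      φ^T≈𝟙 : φ ^ T ≈ 𝟙 [mod + m ]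

  period-1 : ∀ {T} → Period 1 T
  period-1 = period (modℤ-1 _ _ , modℤ-1 _ _)

  module _ {m : ℕ} where
    open Mod (+ m)
    open CommutativeSemiring (commutativeSemiring (+ m)) using (*-identityʳ)
    open import Relation.Binary.Reasoning.Setoid setoid

    period-+ : ∀ {a b} → Period m a → Period m b → Period m (a ℕ.+ b)
    period-+ {a} {b} (period φᵃ≈𝟙) (period φᵇ≈𝟙) = period (begin
      φ ^ (a ℕ.+ b)    ≈⟨ ^-homo-⊗ φ a b ⟩
      φ ^ a ⊗ φ ^ b    ≈⟨ ⊗-cong (+ m) φᵃ≈𝟙 φᵇ≈𝟙 ⟩
      𝟙 ⊗ 𝟙            ≈⟨ *-identityʳ 𝟙 ⟩
      𝟙                ∎)

    period-∸ : ∀ {a b} → Period m (a ℕ.+ b) → Period m b → Period m a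
    period-∸ {a} {b} (period φᵃ⁺ᵇ≈𝟙) (period φᵇ≈𝟙) = period (begin
      φ ^ a            ≈⟨ *-identityʳ (φ ^ a) ⟨
      φ ^ a ⊗ 𝟙        ≈⟨ ⊗-cong (+ m) {φ ^ a} refl φᵇ≈𝟙 ⟨
      φ ^ a ⊗ φ ^ b    ≈⟨ ^-homo-⊗ φ a b ⟨
      φ ^ (a ℕ.+ b)    ≈⟨ φᵃ⁺ᵇ≈𝟙 ⟩
      𝟙                ∎)

    period-*ʳ : ∀ {T} n → Period m T → Period m (T ℕ.* n)
    period-*ʳ {T} n (period φᵀ≈𝟙) = period (begin
      φ ^ (T ℕ.* n)    ≈⟨ ^-assocʳ φ T n ⟨
      (φ ^ T) ^ n      ≈⟨ ^-congˡ n φᵀ≈𝟙 ⟩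
      𝟙 ^ n            ≈⟨ 𝟙^n≈𝟙 n ⟩
      𝟙                ∎)

    period-*ˡ : ∀ {T} n → Period m T → Period m (n ℕ.* T)
    period-*ˡ {T} n φᵀ≈𝟙 = ≡.subst (Period m) (ℕ.*-comm T n) (period-*ʳ n φᵀ≈𝟙)

  period-∣ : ∀ {d m T} → d ∣ m → Period m T → Period d T
  period-∣ d∣m (period φᵀ≈𝟙) = period (≈-∣ (Signed.∣ᵤ⇒∣ d∣m) φᵀ≈𝟙)

  period-coprime : ∀ {m n T} → Coprime m n → Period m T → Period n T → Period (m ℕ.* n) T
  period-coprime {m} {n} {T} m⊥n (period φᵀ≈𝟙) (period φᵀ≈𝟙′) =
    period (≡.subst (φ ^ T ≈ 𝟙 [mod_]) (≡.sym (ℤ.pos-* m n)) (≈-coprime m⊥n φᵀ≈𝟙 φᵀ≈𝟙′))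

  period-lift : ∀ {p m T} → p ∣ m → Period m T → Period (p ℕ.* m) (p ℕ.* T)
  period-lift {p} {m} {T} p∣m (period φᵀ≈𝟙) = period (≡.subst (φ ^ (p ℕ.* T) ≈ 𝟙 [mod_]) (≡.sym (ℤ.pos-* p m)) (begin
    φ ^ (p ℕ.* T)   ≡⟨ cong (φ ^_) (ℕ.*-comm p T) ⟩
    φ ^ (T ℕ.* p)   ≈⟨ ^-assocʳ φ T p ⟨
    (φ ^ T) ^ p     ≈⟨ ^-lift p (Signed.∣ᵤ⇒∣ p∣m) φᵀ≈𝟙 ⟩
    𝟙               ∎))
    where
    open Mod (+ p * + m)
    open import Relation.Binary.Reasoning.Setoid setoid

  period-lift^ : ∀ {p m T} → p ∣ m → Period m T → ∀ j → Period (p ℕ.^ j ℕ.* m) (p ℕ.^ j ℕ.* T)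
  period-lift^ {p} {m} {T} p∣m per zero =
    ≡.subst₂ Period (≡.sym (ℕ.*-identityˡ m)) (≡.sym (ℕ.*-identityˡ T)) per
  period-lift^ {p} {m} {T} p∣m per (suc j) =
    ≡.subst₂ Period (≡.sym (ℕ.*-assoc p (p ℕ.^ j) m)) (≡.sym (ℕ.*-assoc p (p ℕ.^ j) T))
      (period-lift (ℕ.∣n⇒∣m*n (p ℕ.^ j) p∣m) (period-lift^ p∣m per j))

-- Modulo a² + 1 and for k = 2a: φ ≡ a(1 + y) with y = a² − aφ, y² ≡ 0 and a⁴ ≡ 1.
module _ (a : ℤ) where
  open import Data.Integer.Base using (_+_; _*_; -_; _-_)
  open ℤ[φ] (a + a)

  period-a²+1 : ∀ n → + n ≡ a * a + + 1 → Period n (4 ℕ.* n)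
  period-a²+1 n n≡a²+1 = period (≡.subst (φ ^ (4 ℕ.* n) ≈ 𝟙 [mod_]) (≡.sym n≡a²+1) (begin
    φ ^ (4 ℕ.* n)                              ≈⟨ ^-congˡ (4 ℕ.* n) ιa⊗[𝟙⊕y]≈φ ⟨
    (ι a ⊗ (𝟙 ⊕ y)) ^ (4 ℕ.* n)                ≈⟨ ^-distrib-⊗ (ι a) (𝟙 ⊕ y) (4 ℕ.* n) ⟩
    ι a ^ (4 ℕ.* n) ⊗ (𝟙 ⊕ y) ^ (4 ℕ.* n)      ≈⟨ ⊗-cong (a * a + + 1) ιa^4n≈𝟙 (square-zero-binomial y²≈𝟘 (4 ℕ.* n)) ⟩
    𝟙 ⊗ (𝟙 ⊕ ι (+ (4 ℕ.* n)) ⊗ y)             ≈⟨ ⊗-cong (a * a + + 1) {𝟙} refl (⊕-cong (a * a + + 1) {𝟙} refl 4n·y≈𝟘) ⟩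
    𝟙 ⊗ (𝟙 ⊕ 𝟘)                                ≈⟨ +φ-≡ ≡.refl (solve (a ∷ [])) ⟩
    𝟙                                          ∎))
    where
    y = a * a +φ - a
    open Mod (a * a + + 1)
    open import Relation.Binary.Reasoning.Setoid setoid
    y²≈𝟘 : y ⊗ y ≈ 𝟘 [mod a * a + + 1 ]
    y²≈𝟘 = +φ-cong (withQuotient (a * a) (solve (a ∷ []))) (withQuotient (+ 0) (solve (a ∷ [])))
    ιa⊗[𝟙⊕y]≈φ : ι a ⊗ (𝟙 ⊕ y) ≈ φ [mod a * a + + 1 ]
    ιa⊗[𝟙⊕y]≈φ = +φ-cong (withQuotient a (solve (a ∷ []))) (withQuotient (- + 1) (solve (a ∷ [])))
    ιa⁴≈𝟙 : ι a ^ 4 ≈ 𝟙 [mod a * a + + 1 ]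
    ιa⁴≈𝟙 = +φ-cong (withQuotient (a * a - + 1) (solve (a ∷ []))) (withQuotient (+ 0) (solve (a ∷ [])))
    ιa^4n≈𝟙 : ι a ^ (4 ℕ.* n) ≈ 𝟙 [mod a * a + + 1 ]
    ιa^4n≈𝟙 = begin
      ι a ^ (4 ℕ.* n)    ≈⟨ ^-assocʳ (ι a) 4 n ⟨
      (ι a ^ 4) ^ n      ≈⟨ ^-congˡ n ιa⁴≈𝟙 ⟩
      𝟙 ^ n              ≈⟨ 𝟙^n≈𝟙 n ⟩
      𝟙                  ∎
    4n·y≈𝟘 : ι (+ (4 ℕ.* n)) ⊗ y ≈ 𝟘 [mod a * a + + 1 ]
    4n·y≈𝟘 = ι-⊗≈𝟘 (Signed.divides (+ 4) (≡.trans (ℤ.pos-* 4 n) (cong (+ 4 *_) n≡a²+1))) y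

-- K-Fibonacci numbers and their periods

module Fibonacci (K : ℕ) where
  open import Data.Integer.Base using (_+_; _*_)
  open ℤ[φ] (+ K) public

  Fℤ-step : ∀ n → + F K n + + K * + F K (suc n) ≡ + F K (suc (suc n))
  Fℤ-step n = begin
    + F K n + + K * + F K (suc n)     ≡⟨ ℤ.+-comm (+ F K n) (+ K * + F K (suc n)) ⟩
    + K * + F K (suc n) + + F K n     ≡⟨ cong (_+ + F K n) (ℤ.pos-* K (F K (suc n))) ⟨
    + (K ℕ.* F K (suc n)) + + F K n   ≡⟨ ℤ.pos-+ (K ℕ.* F K (suc n)) (F K n) ⟨
    + F K (suc (suc n))               ∎
    where open ≡-Reasoning

  φ^suc≡F : ∀ n → φ ^ suc n ≡ + F K n +φ + F K (suc n)
  φ^suc≡F zero    = ≡.trans (φ-⊗ (+ 1) (+ 0)) (cong (λ z → + 0 +φ (+ 1 + z)) (ℤ.*-zeroʳ (+ K)))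
  φ^suc≡F (suc n) =
    ≡.trans (cong (φ ⊗_) (φ^suc≡F n)) (≡.trans (φ-⊗ (+ F K n) (+ F K (suc n))) (cong (+ F K (suc n) +φ_) (Fℤ-step n)))

  module _ {m : ℕ} where
    open Mod (+ m)
    open CommutativeSemiring (commutativeSemiring (+ m)) using (*-identityʳ)
    open import Relation.Binary.Reasoning.Setoid setoid

    period⇒periodic : ∀ {T} → Period m T → ∀ n → F K (n ℕ.+ T) ≡ F K n [mod m ]
    period⇒periodic {T} (period φᵀ≈𝟙) n = modℤ⇒mod (_≈_[mod_].re-≡ (begin
      + F K (n ℕ.+ T) +φ + F K (suc n ℕ.+ T)   ≡⟨ φ^suc≡F (n ℕ.+ T) ⟨
      φ ^ (suc n ℕ.+ T)                        ≈⟨ ^-homo-⊗ φ (suc n) T ⟩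
      φ ^ suc n ⊗ φ ^ T                        ≈⟨ ⊗-cong (+ m) {φ ^ suc n} refl φᵀ≈𝟙 ⟩
      φ ^ suc n ⊗ 𝟙                            ≈⟨ *-identityʳ (φ ^ suc n) ⟩
      φ ^ suc n                                ≡⟨ φ^suc≡F n ⟩
      + F K n +φ + F K (suc n)                 ∎))

    resets⇒period : ∀ {T} → F K T ≡ 0 [mod m ] → F K (suc T) ≡ 1 [mod m ] → Period m T
    resets⇒period {T} Fᵀ≡0 Fᵀ⁺¹≡1 = period (φ-cancel (begin
      φ ⊗ φ ^ T                      ≡⟨ φ^suc≡F T ⟩
      + F K T +φ + F K (suc T)       ≈⟨ +φ-cong (mod⇒modℤ Fᵀ≡0) (mod⇒modℤ Fᵀ⁺¹≡1) ⟩
      φ                              ≈⟨ *-identityʳ φ ⟨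
      φ ⊗ 𝟙                          ∎))

  Resets : ℕ → ℕ → Set
  Resets m T = 0 < T × F K T ≡ 0 [mod m ] × F K (suc T) ≡ 1 [mod m ]

  resets? : ∀ m → Decidable (Resets m)
  resets? m T = (0 ℕ.<? T) ×-dec (m ∣? ℕ.∣ F K T - 0 ∣) ×-dec (m ∣? ℕ.∣ F K (suc T) - 1 ∣)

  period⇒resets : ∀ {m T} → 0 < T → Period m T → Resets m T
  period⇒resets 0<T φᵀ≈𝟙 = 0<T , period⇒periodic φᵀ≈𝟙 0 , period⇒periodic φᵀ≈𝟙 1

  D : ℕ
  D = K ℕ.* K ℕ.+ 4

  s^[1+2h]≈ι[Dʰ]⊗s : ∀ {M} h → s ^ suc (2 ℕ.* h) ≈ ι (+ (D ℕ.^ h)) ⊗ s [mod M ]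
  s^[1+2h]≈ι[Dʰ]⊗s {M} h = begin
    s ⊗ s ^ (2 ℕ.* h)           ≈⟨ ⊗-cong M {s} refl (sym (^-assocʳ s 2 h)) ⟩
    s ⊗ (s ^ 2) ^ h             ≈⟨ ⊗-cong M {s} refl (trans (^-congˡ h s²≈ιD) (ι-^ D h)) ⟩
    s ⊗ ι (+ (D ℕ.^ h))         ≈⟨ *-comm s (ι (+ (D ℕ.^ h))) ⟩
    ι (+ (D ℕ.^ h)) ⊗ s         ∎
    where
    open Mod M
    open CommutativeSemiring (commutativeSemiring M) using (*-identityʳ; *-comm)
    open import Relation.Binary.Reasoning.Setoid setoid
    s²≈ιD : s ^ 2 ≈ ι (+ D) [mod M ]
    s²≈ιD = begin
      s ⊗ (s ⊗ 𝟙)                 ≈⟨ ⊗-cong M {s} refl (*-identityʳ s) ⟩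
      s ⊗ s                       ≈⟨ s⊗s≈ι ⟩
      ι (+ K * + K + + 4)         ≡⟨ cong (λ z → ι (z + + 4)) (ℤ.pos-* K K) ⟨
      ι (+ D)                     ∎

  -- With p = 2h + 1, the Frobenius maps s to Dʰ s and Dʰ Dʰ ≡ 1.
  s-fixed : ∀ {p} (p-prime : Prime p) {h} → p ≡ suc (2 ℕ.* h) → ¬ p ∣ D → Frobenius²-fixed p-prime s
  s-fixed {p} p-prime {h} ≡.refl p∤D = begin
    (s ^ p) ^ p                 ≈⟨ ^-congˡ p (s^[1+2h]≈ι[Dʰ]⊗s h) ⟩
    (ι Dʰ ⊗ s) ^ p              ≈⟨ ^-distrib-⊗ (ι Dʰ) s p ⟩
    ι Dʰ ^ p ⊗ s ^ p            ≈⟨ ⊗-cong (+ p) (fermat p-prime (D ℕ.^ h)) (s^[1+2h]≈ι[Dʰ]⊗s h) ⟩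
    ι Dʰ ⊗ (ι Dʰ ⊗ s)           ≈⟨ *-assoc (ι Dʰ) (ι Dʰ) s ⟨
    (ι Dʰ ⊗ ι Dʰ) ⊗ s           ≈⟨ ⊗-cong (+ p) (ι[dʰ]⊗ι[dʰ]≈𝟙 p-prime {h} ≡.refl p∤D) (refl {s}) ⟩
    𝟙 ⊗ s                       ≈⟨ *-identityˡ s ⟩
    s                           ∎
    where
    Dʰ = + (D ℕ.^ h)
    open Mod (+ p)
    open CommutativeSemiring (commutativeSemiring (+ p)) using (*-identityˡ; *-assoc)
    open import Relation.Binary.Reasoning.Setoid setoid

  -- φ = (h + 1)(ι K ⊕ s), and the Frobenius applied twice fixes both factors.
  period-odd-prime : ∀ {p h} → Prime p → p ≡ suc (2 ℕ.* h) → ¬ p ∣ D → Period p (p ℕ.* p ℕ.∸ 1)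
  period-odd-prime {p} {h} p-prime ≡.refl p∤D = period (φ-cancel (begin
    φ ^ (p ℕ.* p)               ≈⟨ ^-assocʳ φ p p ⟨
    (φ ^ p) ^ p                 ≈⟨ ^-congˡ p (^-congˡ p w≈φ) ⟨
    (w ^ p) ^ p                 ≈⟨ ⊗-fixed p-prime (ι-fixed p-prime (h ℕ.+ 1))
                                     (⊕-fixed p-prime (ι-fixed p-prime K) (s-fixed p-prime {h} ≡.refl p∤D)) ⟩
    w                           ≈⟨ w≈φ ⟩
    φ                           ≈⟨ *-identityʳ φ ⟨
    φ ⊗ 𝟙                       ∎))
    where
    open Mod (+ p)
    open CommutativeSemiring (commutativeSemiring (+ p)) using (*-identityʳ)
    open import Relation.Binary.Reasoning.Setoid setoid
    w = ι (+ h + + 1) ⊗ (ι (+ K) ⊕ s)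
    w≈φ : w ≈ φ [mod + p ]
    w≈φ = ι[c+1]⊗[ιk⊕s]≈φ {c = + h} (cong +_ (ℕ-Solver.solve (h ∷ [])))

  -- π 0 is a junk value.
  module MinimalPeriod (period-exists : ∀ m → ∃ λ T → 0 < T × Period (suc m) T) where

    least-resets : ∀ m → ∃ λ T → Resets (suc m) T × (∀ {T′} → Resets (suc m) T′ → T ≤ T′)
    least-resets m with period-exists m
    ... | T , 0<T , φᵀ≈𝟙 = least (resets? (suc m)) (period⇒resets 0<T φᵀ≈𝟙)

    π : ℕ → ℕ
    π zero    = 0
    π (suc m) = proj₁ (least-resets m)

    π-resets : ∀ {m} → 0 < m → Resets m (π m)
    π-resets {suc m} _ = proj₁ (proj₂ (least-resets m))

    π-pos : ∀ {m} → 0 < m → 0 < π m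
    π-pos 0<m = proj₁ (π-resets 0<m)

    π-period : ∀ {m} → 0 < m → Period m (π m)
    π-period {m} 0<m = resets⇒period {T = π m} (proj₁ (proj₂ (π-resets 0<m))) (proj₂ (proj₂ (π-resets 0<m)))

    π-least : ∀ {m T} → 0 < m → 0 < T → Period m T → π m ≤ T
    π-least {suc m} _ 0<T φᵀ≈𝟙 = proj₂ (proj₂ (least-resets m)) (period⇒resets 0<T φᵀ≈𝟙)

    π-shortest : ∀ {m} → 0 < m → IsShortestPeriod K m (π m)
    π-shortest {m} 0<m = (π-pos 0<m , period⇒periodic (π-period 0<m)) ,
      λ q (0<q , periodic) → π-least 0<m 0<q (resets⇒period (periodic 0) (periodic 1))

    π-∣ : ∀ {m T} → 0 < m → Period m T → π m ∣ T
    π-∣ {m} {T} 0<m φᵀ≈𝟙 with T ℕ.% π m | m%n<n T (π m) | m≡m%n+[m/n]*n T (π m)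
      where instance _ = ℕ.>-nonZero (π-pos 0<m)
    ... | zero  | _   | T≡[T/π]*π   = divides (T ℕ./ π m) T≡[T/π]*π
      where instance _ = ℕ.>-nonZero (π-pos 0<m)
    ... | suc r | r<π | T≡r+[T/π]*π = contradiction (π-least 0<m z<s φʳ≈𝟙) (ℕ.<⇒≱ r<π)
      where
      instance _ = ℕ.>-nonZero (π-pos 0<m)
      φʳ≈𝟙 : Period m (suc r)
      φʳ≈𝟙 = period-∸ (≡.subst (Period m) T≡r+[T/π]*π φᵀ≈𝟙) (period-*ˡ (T ℕ./ π m) (π-period 0<m))

-- The modules above use the operations of ℤ; from here on _+_, _*_, … are those of ℕ.
open import Data.Nat.Base using (_+_; _*_; _∸_; _^_; _%_; _/_)

prime∣prime⇒≡ : ∀ {q p} → Prime q → Prime p → q ∣ p → q ≡ p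
prime∣prime⇒≡ q-prime p-prime q∣p with prime⇒irreducible p-prime q∣p
... | inj₁ q≡1 = contradiction q≡1 (prime≢1 q-prime)
... | inj₂ q≡p = q≡p

prime∣^⇒∣ : ∀ {q p} → Prime q → ∀ j → q ∣ p ^ j → q ∣ p
prime∣^⇒∣ q-prime zero    q∣1 = contradiction (ℕ.∣1⇒≡1 q∣1) (prime≢1 q-prime)
prime∣^⇒∣ {p = p} q-prime (suc j) q∣pʲ⁺¹ with euclidsLemma p (p ^ j) q-prime q∣pʲ⁺¹
... | inj₁ q∣p  = q∣p
... | inj₂ q∣pʲ = prime∣^⇒∣ q-prime j q∣pʲ

prime∤⇒coprime : ∀ {p c} → Prime p → ¬ p ∣ c → Coprime p c
prime∤⇒coprime p-prime p∤c (i∣p , i∣c) with prime⇒irreducible p-prime i∣p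
... | inj₁ i≡1   = i≡1
... | inj₂ ≡.refl = contradiction i∣c p∤c

¬2∣⇒odd : ∀ {n} → ¬ 2 ∣ n → ∃ λ h → n ≡ suc (2 * h)
¬2∣⇒odd {n} 2∤n with n % 2 | m%n<n n 2 | m≡m%n+[m/n]*n n 2
... | 0           | _             | n≡[n/2]*2   = contradiction (divides (n / 2) n≡[n/2]*2) 2∤n
... | 1           | _             | n≡1+[n/2]*2 = n / 2 , ≡.trans n≡1+[n/2]*2 (cong suc (ℕ.*-comm (n / 2) 2))
... | suc (suc _) | s≤s (s≤s ()) | _

^-∣-^ : ∀ b {i j} → i ≤ j → b ^ i ∣ b ^ j
^-∣-^ b {i} {j} i≤j =
  divides (b ^ (j ∸ i)) (≡.trans (cong (b ^_) (≡.sym (ℕ.m∸n+n≡m i≤j))) (ℕ.^-distribˡ-+-* b (j ∸ i) i))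

power∣⇒≤ : ∀ {p t i k} → Prime p → ¬ p ∣ t → p ^ i ∣ p ^ k * t → i ≤ k
power∣⇒≤ {p} {t} {i} {k} p-prime p∤t pⁱ∣pᵏt = ℕ.≮⇒≥ k≮i
  where
  k≮i : ¬ k < i
  k≮i k<i = p∤t (ℕ.*-cancelˡ-∣ (p ^ k) {{ℕ.m^n≢0 p k {{ℕ.>-nonZero (ℕ.<-trans z<s (prime>1 p-prime))}}}}
    (≡.subst (_∣ p ^ k * t) (ℕ.*-comm p (p ^ k)) (∣-trans (^-∣-^ p k<i) pⁱ∣pᵏt)))

split-power : ∀ {b} → 1 < b → ∀ {m} → 0 < m → ∃₂ λ j c → m ≡ b ^ j * c × ¬ b ∣ c × 0 < c
split-power {b} 1<b {m} 0<m = split (<-wellFounded m) 0<m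
  where
  split : ∀ {m} → Acc _<_ m → 0 < m → ∃₂ λ j c → m ≡ b ^ j * c × ¬ b ∣ c × 0 < c
  split {m} (acc rec) 0<m with b ∣? m
  ... | no b∤m = 0 , m , ≡.sym (ℕ.*-identityˡ m) , b∤m , 0<m
  ... | yes (divides zero ≡.refl) = contradiction 0<m (ℕ.<-irrefl ≡.refl)
  ... | yes (divides q@(suc _) ≡.refl) with split (rec (ℕ.m<m*n q b 1<b)) z<s
  ...   | j , c , q≡bʲc , b∤c , 0<c = suc j , c , q*b≡bʲ⁺¹c , b∤c , 0<c
    where
    q*b≡bʲ⁺¹c : q * b ≡ b * b ^ j * c
    q*b≡bʲ⁺¹c = begin
      q * b               ≡⟨ cong (_* b) q≡bʲc ⟩
      b ^ j * c * b       ≡⟨ ℕ.*-comm (b ^ j * c) b ⟩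
      b * (b ^ j * c)     ≡⟨ ℕ.*-assoc b (b ^ j) c ⟨
      b * b ^ j * c       ∎
      where open ≡-Reasoning

-- Smooth periods for even K

module EvenK {K : ℕ} (K-even : 2 ∣ K) where
  open Fibonacci K hiding (_^_)

  2∣D : 2 ∣ D
  2∣D = ℕ.∣m∣n⇒∣m+n (ℕ.∣m⇒∣m*n K K-even) (divides 2 ≡.refl)

  period-two : Period 2 2
  period-two = period (≡.subst (_≈ 𝟙 [mod + 2 ]) (≡.sym (φ^suc≡F 1))
    (+φ-cong modℤ-refl (mod⇒modℤ (≡.subst (2 ∣_) K≡∣F₂-0∣ K-even))))
    where
    K≡∣F₂-0∣ : K ≡ ℕ.∣ F K 2 - 0 ∣
    K≡∣F₂-0∣ = ≡.sym (≡.trans (ℕ.∣-∣-identityʳ (K * 1 + 0)) (≡.trans (ℕ.+-identityʳ (K * 1)) (ℕ.*-identityʳ K)))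

  period-prime∣D : ∀ {p} → Prime p → p ∣ D → Period p D
  period-prime∣D {p} p-prime p∣D = period-prime∣4[h²+1] (_∣_.quotient K-even) (_∣_.equality K-even)
    where
    period-prime∣4[h²+1] : ∀ h → K ≡ h * 2 → Period p D
    period-prime∣4[h²+1] h K≡h*2 =
      ≡.subst (Period p) (≡.sym D≡4M) (period-factor (euclidsLemma 4 M p-prime (≡.subst (p ∣_) D≡4M p∣D)))
      where
      M = h * h + 1
      D≡4M : D ≡ 4 * M
      D≡4M = ≡.trans (cong (λ k → k * k + 4) K≡h*2) [h*2]²+4≡4[h²+1]
        where
        [h*2]²+4≡4[h²+1] : h * 2 * (h * 2) + 4 ≡ 4 * (h * h + 1)
        [h*2]²+4≡4[h²+1] = ℕ-Solver.solve (h ∷ [])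
      period-factor : p ∣ 4 ⊎ p ∣ M → Period p (4 * M)
      period-factor (inj₁ p∣4) = ≡.subst (λ q → Period q (4 * M)) (≡.sym p≡2) (period-*ʳ M (period-+ period-two period-two))
        where
        p∣2 : p ∣ 2
        p∣2 = [ id , id ]′ (euclidsLemma 2 2 p-prime p∣4)
        p≡2 : p ≡ 2
        p≡2 = ℕ.≤-antisym (ℕ.∣⇒≤ p∣2) (prime>1 p-prime)
      period-factor (inj₂ p∣M) = period-∣ p∣M (≡.subst (λ k → ℤ[φ].Period k M (4 * M)) 2h≡K
                                   (period-a²+1 (+ h) M (≡.trans (ℤ.pos-+ (h * h) 1) (cong (ℤ._+ + 1) (ℤ.pos-* h h)))))
        where
        2h≡K : + h ℤ.+ + h ≡ + K
        2h≡K = cong +_ (≡.sym (≡.trans K≡h*2 (ℕ-Solver.solve (h ∷ []))))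

  odd-prime∤D : ∀ {p} → Prime p → ¬ p ∣ D → ∃ λ h → p ≡ suc (2 * h)
  odd-prime∤D {p} p-prime p∤D = ¬2∣⇒odd 2∤p
    where
    2∤p : ¬ 2 ∣ p
    2∤p 2∣p with prime⇒irreducible p-prime 2∣p
    ... | inj₁ ()
    ... | inj₂ 2≡p = p∤D (≡.subst (_∣ D) 2≡p 2∣D)

  period-prime∤D : ∀ {p} → Prime p → ¬ p ∣ D → Period p (p * p ∸ 1)
  period-prime∤D p-prime p∤D with odd-prime∤D p-prime p∤D
  ... | h , p≡1+2h = period-odd-prime {h = h} p-prime p≡1+2h p∤D

  Smooth : ℕ → ℕ → Set
  Smooth B x = ∀ {q} → Prime q → q ∣ x → q ∣ D ⊎ q < B

  smooth-∣ : ∀ {B d x} → d ∣ x → Smooth B x → Smooth B d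
  smooth-∣ d∣x x-smooth q-prime q∣d = x-smooth q-prime (∣-trans q∣d d∣x)

  smooth-* : ∀ {B x y} → Smooth B x → Smooth B y → Smooth B (x * y)
  smooth-* {x = x} {y} x-smooth y-smooth q-prime q∣xy =
    [ x-smooth q-prime , y-smooth q-prime ]′ (euclidsLemma x y q-prime q∣xy)

  smooth-mono : ∀ {B B′ x} → B ≤ B′ → Smooth B x → Smooth B′ x
  smooth-mono B≤B′ x-smooth q-prime q∣x = [ inj₁ , (λ q<B → inj₂ (ℕ.<-≤-trans q<B B≤B′)) ]′ (x-smooth q-prime q∣x)

  smooth-prime : ∀ {B p} → Prime p → p ∣ D ⊎ p < B → Smooth B p
  smooth-prime p-prime p-small q-prime q∣p rewrite prime∣prime⇒≡ q-prime p-prime q∣p = p-small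

  smooth-D : ∀ {B} → Smooth B D
  smooth-D _ q∣D = inj₁ q∣D

  smooth-1 : ∀ {B} → Smooth B 1
  smooth-1 q-prime q∣1 = contradiction (ℕ.∣1⇒≡1 q∣1) (prime≢1 q-prime)

  smooth-self : ∀ {m} → 0 < m → Smooth (suc m) m
  smooth-self 0<m _ q∣m = inj₂ (s≤s (ℕ.∣⇒≤ {{ℕ.>-nonZero 0<m}} q∣m))

  smooth-^ : ∀ {p} → Prime p → ∀ j → Smooth (suc p) (p ^ j)
  smooth-^ {p} p-prime j q-prime q∣pʲ =
    inj₂ (s≤s (ℕ.∣⇒≤ {{ℕ.>-nonZero (ℕ.<-trans z<s (prime>1 p-prime))}} (prime∣^⇒∣ q-prime j q∣pʲ)))

  smooth-pred : ∀ {B x} → (Prime B → B ∣ x → B ∣ D) → Smooth (suc B) x → Smooth B x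
  smooth-pred {B} B∣x⇒B∣D x-smooth {q} q-prime q∣x with x-smooth q-prime q∣x
  ... | inj₁ q∣D = inj₁ q∣D
  ... | inj₂ q<1+B with ℕ.m<1+n⇒m<n∨m≡n q<1+B
  ...   | inj₁ q<B    = inj₂ q<B
  ...   | inj₂ ≡.refl = inj₁ (B∣x⇒B∣D q-prime q∣x)

  smooth⇒∤ : ∀ {B x} → Prime B → ¬ B ∣ D → Smooth B x → ¬ B ∣ x
  smooth⇒∤ B-prime B∤D x-smooth B∣x = [ B∤D , ℕ.<-irrefl ≡.refl ]′ (x-smooth B-prime B∣x)

  smooth-p²-1 : ∀ {p} → Prime p → ¬ p ∣ D → Smooth p (p * p ∸ 1)
  smooth-p²-1 {p} p-prime p∤D {q} q-prime q∣p²-1 with odd-prime∤D p-prime p∤D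
  ... | zero , ≡.refl = contradiction ≡.refl (prime≢1 p-prime)
  ... | h@(suc _) , ≡.refl with euclidsLemma (2 * h) (2 * (h + 1)) q-prime (≡.subst (q ∣_) (p²-1≡2h*2[h+1] h) q∣p²-1)
    where
    p²-1≡2h*2[h+1] : ∀ h → 2 * h + 2 * h * suc (2 * h) ≡ 2 * h * (2 * (h + 1))
    p²-1≡2h*2[h+1] h = ℕ-Solver.solve (h ∷ [])
  ... | inj₁ q∣2h = inj₂ (s≤s (ℕ.∣⇒≤ q∣2h))
  ... | inj₂ q∣2[h+1] with euclidsLemma 2 (h + 1) q-prime q∣2[h+1]
  ...   | inj₁ q∣2   = inj₁ (≡.subst (_∣ D) (ℕ.≤-antisym (prime>1 q-prime) (ℕ.∣⇒≤ q∣2)) 2∣D)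
  ...   | inj₂ q∣h+1 = inj₂ (s≤s (ℕ.≤-trans (ℕ.∣⇒≤ q∣h+1) (ℕ.+-monoʳ-≤ h (s≤s z≤n))))

  prime-period : ∀ {B p} → Prime p → p ∣ D ⊎ p < B → ∃ λ T → 0 < T × Period p T × Smooth B T
  prime-period {B} {p} p-prime p-small with p ∣? D
  ... | yes p∣D = D , ℕ.<-≤-trans z<s (ℕ.m≤n+m 4 (K * K)) , period-prime∣D p-prime p∣D , smooth-D
  ... | no p∤D  = p * p ∸ 1 , 0<p²-1 , period-prime∤D p-prime p∤D ,
                  smooth-mono (ℕ.<⇒≤ p<B) (smooth-p²-1 p-prime p∤D)
    where
    p<B : p < B
    p<B = [ (λ p∣D → contradiction p∣D p∤D) , id ]′ p-small
    0<p²-1 : 0 < p * p ∸ 1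
    0<p²-1 = ℕ.m<n⇒0<n∸m (ℕ.*-mono-< (prime>1 p-prime) (prime>1 p-prime))

  product-period : ∀ {B} qs → All Prime qs → Smooth B (product qs) →
                   ∃ λ T → 0 < T × Period (product qs) T × Smooth B T
  product-period [] _ _ = 1 , z<s , period-1 , smooth-1
  product-period (p ∷ qs) (p-prime All.∷ qs-prime) pqs-smooth
    with product-period qs qs-prime (smooth-∣ (ℕ.n∣m*n p) pqs-smooth) | p ∣? product qs
  ... | T , 0<T , per , T-smooth | yes p∣qs =
    p * T , ℕ.*-mono-< (ℕ.<-trans z<s (prime>1 p-prime)) 0<T , period-lift p∣qs per ,
    smooth-* (smooth-prime p-prime (pqs-smooth p-prime (ℕ.m∣m*n (product qs)))) T-smooth
  ... | T , 0<T , per , T-smooth | no p∤qs with prime-period p-prime (pqs-smooth p-prime (ℕ.m∣m*n (product qs)))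
  ...   | Tₚ , 0<Tₚ , perₚ , Tₚ-smooth =
    Tₚ * T , ℕ.*-mono-< 0<Tₚ 0<T ,
    period-coprime (prime∤⇒coprime p-prime p∤qs) (period-*ʳ T perₚ) (period-*ˡ Tₚ per) ,
    smooth-* Tₚ-smooth T-smooth

  smooth-period : ∀ {B m} → 0 < m → Smooth B m → ∃ λ T → 0 < T × Period m T × Smooth B T
  smooth-period {B} {m} 0<m m-smooth =
    ≡.subst (λ n → ∃ λ T → 0 < T × Period n T × Smooth B T) (≡.sym isFactorisation)
      (product-period factors factorsPrime (≡.subst (Smooth B) isFactorisation m-smooth))
    where open PrimeFactorisation (factorise m {{ℕ.>-nonZero 0<m}})

  period-exists : ∀ m → ∃ λ T → 0 < T × Period (suc m) T
  period-exists m with smooth-period z<s (smooth-self z<s)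
  ... | T , 0<T , per , _ = T , 0<T , per

  open MinimalPeriod period-exists public

  π-smooth : ∀ {B m} → 0 < m → Smooth B m → Smooth B (π m)
  π-smooth 0<m m-smooth with smooth-period 0<m m-smooth
  ... | T , _ , per , T-smooth = smooth-∣ (π-∣ 0<m per) T-smooth

  π-iterate-pos : ∀ {m} → 0 < m → ∀ n → 0 < fold m π n
  π-iterate-pos 0<m zero    = 0<m
  π-iterate-pos 0<m (suc n) = π-pos (π-iterate-pos 0<m n)

  EventuallySmooth : ℕ → Set
  EventuallySmooth m = ∃ λ N → Smooth 0 (fold m π N)

  eventuallySmooth-π : ∀ {m} → EventuallySmooth (π m) → EventuallySmooth m
  eventuallySmooth-π {m} (N , smooth) = N + 1 , ≡.subst (Smooth 0) (≡.sym (fold-+ m π N)) smooth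

  power-period : ∀ {p c} → Prime p → ¬ p ∣ D → ¬ p ∣ c → 0 < c → Smooth p c →
                 ∀ j → ∃ λ T → Smooth p T × Period (p ^ suc j * c) (p ^ j * T)
  power-period {p} {c} p-prime p∤D p∤c 0<c c-smooth j with smooth-period 0<c c-smooth
  ... | Tc , _ , per-c , Tc-smooth =
    (p * p ∸ 1) * Tc , smooth-* (smooth-p²-1 p-prime p∤D) Tc-smooth ,
    ≡.subst (λ n → Period n (p ^ j * ((p * p ∸ 1) * Tc))) pʲ[pc]≡pʲ⁺¹c (period-lift^ (ℕ.m∣m*n c) per-pc j)
    where
    per-pc : Period (p * c) ((p * p ∸ 1) * Tc)
    per-pc = period-coprime (prime∤⇒coprime p-prime p∤c)
               (period-*ʳ Tc (period-prime∤D p-prime p∤D)) (period-*ˡ (p * p ∸ 1) per-c)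
    pʲ[pc]≡pʲ⁺¹c : p ^ j * (p * c) ≡ p ^ suc j * c
    pʲ[pc]≡pʲ⁺¹c = ≡.trans (≡.sym (ℕ.*-assoc (p ^ j) p c)) (cong (_* c) (ℕ.*-comm (p ^ j) p))

  -- Induction on B, and for a prime B ∤ D on the multiplicity j of B in m:
  -- π m divides B^(j−1) T with B ∤ T.
  eventuallySmooth : ∀ B {m} → 0 < m → Smooth B m → EventuallySmooth m
  eventuallySmooth zero    0<m m-smooth = 0 , m-smooth
  eventuallySmooth (suc B) 0<m m-smooth with prime? B | B ∣? D
  ... | no ¬B-prime | _ = eventuallySmooth B 0<m (smooth-pred (λ B-prime _ → contradiction B-prime ¬B-prime) m-smooth)
  ... | yes _ | yes B∣D = eventuallySmooth B 0<m (smooth-pred (λ _ _ → B∣D) m-smooth)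
  ... | yes B-prime | no B∤D with split-power (prime>1 B-prime) 0<m
  ...   | j , c , m≡Bʲc , B∤c , 0<c = descend (<-wellFounded j) m≡Bʲc B∤c 0<c 0<m m-smooth
    where
    descend : ∀ {j m c} → Acc _<_ j → m ≡ B ^ j * c → ¬ B ∣ c → 0 < c → 0 < m → Smooth (suc B) m → EventuallySmooth m
    descend {zero} {m} {c} _ m≡c B∤c _ 0<m m-smooth =
      eventuallySmooth B 0<m (smooth-pred (λ _ B∣m → contradiction (≡.subst (B ∣_) (≡.trans m≡c (ℕ.*-identityˡ c)) B∣m) B∤c) m-smooth)
    descend {suc j} {m} {c} (acc rec) ≡.refl B∤c 0<c 0<m m-smooth
      with power-period B-prime B∤D B∤c 0<c (smooth-pred (λ _ B∣c → contradiction B∣c B∤c) (smooth-∣ (ℕ.n∣m*n (B ^ suc j)) m-smooth)) j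
         | split-power (prime>1 B-prime) (π-pos 0<m)
    ... | T , T-smooth , per | j′ , c′ , πm≡Bʲ′c′ , B∤c′ , 0<c′ =
      eventuallySmooth-π (descend (rec (s≤s j′≤j)) πm≡Bʲ′c′ B∤c′ 0<c′ (π-pos 0<m) πm-smooth)
      where
      πm∣BʲT : π m ∣ B ^ j * T
      πm∣BʲT = π-∣ 0<m per
      πm-smooth : Smooth (suc B) (π m)
      πm-smooth = smooth-∣ πm∣BʲT (smooth-* (smooth-^ B-prime j) (smooth-mono (ℕ.n≤1+n B) T-smooth))
      j′≤j : j′ ≤ j
      j′≤j = power∣⇒≤ B-prime (smooth⇒∤ B-prime B∤D T-smooth)
               (∣-trans (≡.subst (B ^ j′ ∣_) (≡.sym πm≡Bʲ′c′) (ℕ.m∣m*n c′)) πm∣BʲT)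

  eventually-always-smooth : ∀ {m} → 0 < m → ∃ λ N → ∀ n → N ≤ n → Smooth 0 (fold m π n)
  eventually-always-smooth {m} 0<m with eventuallySmooth (suc m) 0<m (smooth-self 0<m)
  ... | N , smooth-N = N , λ n N≤n → ≡.subst (λ i → Smooth 0 (fold m π i)) (ℕ.m∸n+n≡m N≤n) (after (n ∸ N))
    where
    after : ∀ d → Smooth 0 (fold m π (d + N))
    after zero    = smooth-N
    after (suc d) = π-smooth (π-iterate-pos 0<m (d + N)) (after d)

prodPow-zeros : ∀ {r} (ps : Vec ℕ r) → prodPow ps (replicate r 0) ≡ 1
prodPow-zeros Vec.[]       = ≡.refl
prodPow-zeros (p Vec.∷ ps) = ≡.trans (ℕ.+-identityʳ _) (prodPow-zeros ps)

prodPow-updateAt-suc : ∀ {r} (ps js : Vec ℕ r) i → prodPow ps (updateAt js i suc) ≡ lookup ps i * prodPow ps js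
prodPow-updateAt-suc (p Vec.∷ ps) (j Vec.∷ js) zero    = ℕ.*-assoc p (p ^ j) (prodPow ps js)
prodPow-updateAt-suc (p Vec.∷ ps) (j Vec.∷ js) (suc i) = begin
  p ^ j * prodPow ps (updateAt js i suc)   ≡⟨ cong (p ^ j *_) (prodPow-updateAt-suc ps js i) ⟩
  p ^ j * (lookup ps i * prodPow ps js)    ≡⟨ ℕ.*-assoc (p ^ j) (lookup ps i) (prodPow ps js) ⟨
  p ^ j * lookup ps i * prodPow ps js      ≡⟨ cong (_* prodPow ps js) (ℕ.*-comm (p ^ j) (lookup ps i)) ⟩
  lookup ps i * p ^ j * prodPow ps js      ≡⟨ ℕ.*-assoc (lookup ps i) (p ^ j) (prodPow ps js) ⟩
  lookup ps i * (p ^ j * prodPow ps js)    ∎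
  where open ≡-Reasoning

product≡prodPow : ∀ {r} (ps : Vec ℕ r) {qs} → All (λ q → ∃ λ i → lookup ps i ≡ q) qs →
                  ∃ λ js → product qs ≡ prodPow ps js
product≡prodPow {r} ps All.[] = replicate r 0 , ≡.sym (prodPow-zeros ps)
product≡prodPow ps ((i , ≡.refl) All.∷ qs∈ps) with product≡prodPow ps qs∈ps
... | js , eq = updateAt js i suc , ≡.trans (cong (lookup ps i *_) eq) (≡.sym (prodPow-updateAt-suc ps js i))

2∣K : ∀ {K} → K % 4 ≡ 0 ⊎ K % 4 ≡ 2 → 2 ∣ K
2∣K (inj₁ K%4≡0) = ℕ.∣n∣m%n⇒∣m (divides 2 ≡.refl) (≡.subst (2 ∣_) (≡.sym K%4≡0) (divides 0 ≡.refl))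
2∣K (inj₂ K%4≡2) = ℕ.∣n∣m%n⇒∣m (divides 2 ≡.refl) (≡.subst (2 ∣_) (≡.sym K%4≡2) ℕ.∣-refl)

theorem4p7 : (K : ℕ) → 1 ≤ K → (K % 4 ≡ 0 ⊎ K % 4 ≡ 2) →
    (r : ℕ) (ps : Vec ℕ r) → Injective _≡_ _≡_ (lookup ps) →
    (∀ i → Prime (lookup ps i) × lookup ps i ∣ K * K + 4) →
    (∀ p → Prime p → p ∣ K * K + 4 → ∃ λ i → lookup ps i ≡ p) →
    (m : ℕ) → 1 < m →
    Σ (ℕ → ℕ) λ a → a 0 ≡ m × (∀ n → IsShortestPeriod K (a n) (a (suc n))) ×
      ∃ λ N → ∀ n → N ≤ n → ∃ λ (js : Vec ℕ r) → a (suc n) ≡ prodPow ps js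
theorem4p7 K _ K%4∈02 r ps _ _ ps-covers m 1<m with eventually-always-smooth (ℕ.<-trans z<s 1<m)
  where open EvenK (2∣K {K} K%4∈02)
... | N , smooth =
  fold m π , ≡.refl , (λ n → π-shortest (π-iterate-pos 0<m n)) , N ,
  λ n N≤n → prodPow-form (π-iterate-pos 0<m (suc n)) (smooth (suc n) (ℕ.m≤n⇒m≤1+n N≤n))
  where
  open EvenK (2∣K {K} K%4∈02)
  0<m = ℕ.<-trans z<s 1<m
  prodPow-form : ∀ {x} → 0 < x → Smooth 0 x → ∃ λ js → x ≡ prodPow ps js
  prodPow-form {x} 0<x x-smooth =
    let js , eq = product≡prodPow ps (All.tabulate λ q∈ → ps-covers _ (All.lookup factorsPrime q∈)
                    ([ id , (λ ()) ]′ (x-smooth (All.lookup factorsPrime q∈) (≡.subst (_ ∣_) (≡.sym isFactorisation) (∈⇒∣product q∈)))))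
    in js , ≡.trans isFactorisation eq
    where open PrimeFactorisation (factorise x {{ℕ.>-nonZero 0<x}})
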